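{- Let $n\ge3$, $k\in\{2,\ldots,n-1\}$, let $T^{k,n}=(N_1,\ldots,N_t)$ be the problem instance defined in the context, and let $1\le s\le\binom{n-1}{k}2^k$. Then $$f_{T^{k,n}}(N_s)=(2^n-2^{n-k})\sum_{k'=0}^{k}\binom{k}{k'}\binom{n-k-1}{k-k'}.$$
   Context: Binary attributes $V_1,\ldots,V_n$, each with domain $\{0,1\}$. For $Q\subseteq\{V_1,\ldots,V_{n-1}\}$, $\mathrm{Inst}(Q)$ is the set of assignments of values in $\{0,1\}$ to the attributes of $Q$ (contexts). A (complete) CPT $N$ for $V_n$ consists of a parent set $Pa(N,V_n)\subseteq\{V_1,\ldots,V_{n-1}\}$ and, for each $\gamma\in\mathrm{Inst}(Pa(N,V_n))$, exactly one rule, either $\gamma:0\succ 1$ or $\gamma:1\succ 0$. A swap over $V_n$ is identified with an element $x\in\{0,1\}^{n-1}$; the vote of $N$ on $x$ is $0$ if the rule of $N$ whose context agrees with $x$ on $Pa(N,V_n)$ is of the form $\gamma:0\succ1$, and $1$ otherwise. $\Delta(N,N')$ is the number of swaps on which $N,N'$ vote differently, and for $T=(N_1,\ldots,N_t)$, $f_T(N)=\sum_{s=1}^t\Delta(N,N_s)$. The instance $T^{k,n}=(N_1,\ldots,N_t)$ has $t=\binom{n-1}{k}2^k$, with indices $s$ in bijection with pairs $(P,\gamma)$, $P$ a $k$-element subset of $\{V_1,\ldots,V_{n-1}\}$ and $\gamma\in\mathrm{Inst}(P)$; the CPT $N_s$ for $(P,\gamma)$ has parent set $P$, the rule $\gamma:1\succ0$,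 and $\gamma':0\succ1$ for all $\gamma'\in\mathrm{Inst}(P)\setminus\{\gamma\}$. Binomial coefficients $\binom{a}{b}$ with $b>a$ or $b<0$ are $0$. -}

module Defs where

open import Data.Bool using (Bool; true; false; _∧_; _xor_; if_then_else_; not)
open import Data.Nat using (ℕ; zero; suc; _+_; _*_; _∸_; _^_; _≡ᵇ_)
open import Data.Nat.Combinatorics using (_C_)
open import Data.Product using (_×_; _,_)
open import Data.Unit using (⊤; tt)
open import Data.List using (List; []; _∷_; map; filter; length; concatMap; upTo; _++_)
open import Data.Nat.ListAction using (sum)
open import Data.Vec using (Vec; []; _∷_)

-- Attributes V_1..V_{m} with m = n-1 are the coordinates of Vec Bool m.
-- Bool encodes the value: false = 0, true = 1.

-- all assignments {0,1}^m  (= all swaps over V_n, and also all subsets of the attributes)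
allVecs : (m : ℕ) → List (Vec Bool m)
allVecs zero = [] ∷ []
allVecs (suc m) = map (false ∷_) (allVecs m) ++ map (true ∷_) (allVecs m)

size : ∀ {m} → Vec Bool m → ℕ
size [] = 0
size (true ∷ P) = suc (size P)
size (false ∷ P) = size P

Inst : ∀ {m} → Vec Bool m → Set
Inst [] = ⊤
Inst (true ∷ P) = Bool × Inst P
Inst (false ∷ P) = Inst P

allInst : ∀ {m} (P : Vec Bool m) → List (Inst P)
allInst [] = tt ∷ []
allInst (true ∷ P) = map (false ,_) (allInst P) ++ map (true ,_) (allInst P)
allInst (false ∷ P) = allInst P

restrict : ∀ {m} (P : Vec Bool m) → Vec Bool m → Inst P
restrict [] [] = tt
restrict (true ∷ P) (b ∷ x) = b , restrict P x
restrict (false ∷ P) (b ∷ x) = restrict P x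

boolEq : Bool → Bool → Bool
boolEq a b = not (a xor b)

instEq : ∀ {m} (P : Vec Bool m) → Inst P → Inst P → Bool
instEq [] _ _ = true
instEq (true ∷ P) (a , g) (b , h) = boolEq a b ∧ instEq P g h
instEq (false ∷ P) g h = instEq P g h

-- A complete CPT for V_n (n = m+1): a parent set and, for every context
-- γ ∈ Inst(Pa), exactly one rule: rule γ = true means γ : 1 ≻ 0, false means γ : 0 ≻ 1.
record CPT (m : ℕ) : Set where
  constructor cpt
  field
    parents : Vec Bool m
    rule    : Inst parents → Bool
open CPT public

vote : ∀ {m} → CPT m → Vec Bool m → Bool
vote N x = rule N (restrict (parents N) x)

count : ∀ {A : Set} → (A → Bool) → List A → ℕ
count p xs = length (filter (λ x → Data.Bool.T? (p x)) xs)
  where import Data.Bool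

Δ : ∀ {m} → CPT m → CPT m → ℕ
Δ {m} N N' = count (λ x → vote N x xor vote N' x) (allVecs m)

f : ∀ {m} → List (CPT m) → CPT m → ℕ
f T N = sum (map (Δ N) T)

Nγ : ∀ {m} (P : Vec Bool m) → Inst P → CPT m
Nγ P γ = cpt P (λ γ' → instEq P γ' γ)

Tkn : (k m : ℕ) → List (CPT m)
Tkn k m = concatMap (λ P → map (Nγ P) (allInst P))
                    (filter (λ P → Data.Nat._≟_ (size P) k) (allVecs m))
  where import Data.Nat

rhs : (k n : ℕ) → ℕ
rhs k n = (2 ^ n ∸ 2 ^ (n ∸ k)) *
          sum (map (λ k' → (k C k') * ((n ∸ k ∸ 1) C (k ∸ k'))) (upTo (suc k)))

-- Fix N = N_(P,γ) with |P| = k and write m = n - 1. Count the disagreements between N and a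
-- block {N_(P',γ') | γ' ∈ Inst(P')} with |P'| = k swap by swap: on a swap x agreeing with γ on P,
-- N votes 1 and exactly 2^k - 1 CPTs of the block vote 0; on any other swap N votes 0 and exactly
-- one CPT of the block votes 1. Since 2^(m-k) of the 2^m swaps agree with γ, every block
-- contributes 2^(m-k) (2^k - 1) + 2^m - 2^(m-k) = 2^n - 2^(n-k). There are C(m,k) blocks, and
-- C(m,k) = Σ_k' C(k,k') C(m-k,k-k') by Vandermonde's identity.

module Submission where

open import Defs
open import Data.Bool using (Bool; true; false; not; _xor_)
open import Data.Fin using (Fin)
open import Data.List using (List; []; _∷_; _++_; map; filter; length; concatMap; upTo; lookup)
open import Data.List.Properties using (map-++; map-∘; map-cong; map-applyUpTo; map-upTo; length-++; length-map)
open import Data.List.Membership.Propositional using (_∈_; find)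
open import Data.List.Membership.Propositional.Properties using (∈-lookup; ∈-concatMap⁻; ∈-filter⁻; ∈-map⁻)
open import Data.List.Relation.Unary.All as All using (All; []; _∷_)
open import Data.List.Relation.Unary.All.Properties using (all-filter)
open import Data.Nat using (ℕ; zero; suc; _+_; _*_; _∸_; _^_; _≡ᵇ_; _≤_; s≤s; z≤n)
open import Data.Nat.Combinatorics using (_C_; nCk+nC[k+1]≡[n+1]C[k+1])
open import Data.Nat.ListAction using (sum)
open import Data.Nat.ListAction.Properties using (sum-++)
open import Data.Nat.Properties
open import Algebra.Properties.CommutativeSemigroup +-commutativeSemigroup using (interchange)
open import Data.Product using (∃-syntax; _×_; _,_; proj₂)
open import Data.Vec using (Vec; []; _∷_)
open import Function using (_∘_)
open import Relation.Binary.PropositionalEquality using (_≡_; refl; sym; trans; cong; cong₂; module ≡-Reasoning)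
open import Relation.Nullary using (Dec; does)
open ≡-Reasoning

private variable
  A B : Set
  m : ℕ

toℕ : Bool → ℕ
toℕ false = 0
toℕ true  = 1

sum-map-++ : ∀ (g : A → ℕ) xs ys → sum (map g (xs ++ ys)) ≡ sum (map g xs) + sum (map g ys)
sum-map-++ g xs ys = trans (cong sum (map-++ g xs ys)) (sum-++ (map g xs) (map g ys))

sum-map-+ : ∀ (g h : A → ℕ) xs →
  sum (map (λ x → g x + h x) xs) ≡ sum (map g xs) + sum (map h xs)
sum-map-+ g h []       = refl
sum-map-+ g h (x ∷ xs) = trans (cong (g x + h x +_) (sum-map-+ g h xs)) (interchange (g x) (h x) _ _)

sum-map-*ˡ : ∀ c (g : A → ℕ) xs → sum (map (λ x → c * g x) xs) ≡ c * sum (map g xs)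
sum-map-*ˡ c g []       = sym (*-zeroʳ c)
sum-map-*ˡ c g (x ∷ xs) = trans (cong (c * g x +_) (sum-map-*ˡ c g xs)) (sym (*-distribˡ-+ c (g x) _))

sum-map-≡const : ∀ {g : A → ℕ} {c xs} → All (λ x → g x ≡ c) xs → sum (map g xs) ≡ length xs * c
sum-map-≡const []           = refl
sum-map-≡const (gx≡c ∷ all) = cong₂ _+_ gx≡c (sum-map-≡const all)

sum-map-const : ∀ c (xs : List A) → sum (map (λ _ → c) xs) ≡ length xs * c
sum-map-const c xs = sum-map-≡const (All.universal (λ _ → refl) xs)

sum-map-swap : ∀ (g : A → B → ℕ) xs ys →
  sum (map (λ x → sum (map (g x) ys)) xs) ≡ sum (map (λ y → sum (map (λ x → g x y) xs)) ys)
sum-map-swap g []       ys = sym (trans (sum-map-const 0 ys) (*-zeroʳ (length ys)))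
sum-map-swap g (x ∷ xs) ys =
  trans (cong (sum (map (g x) ys) +_) (sum-map-swap g xs ys)) (sym (sum-map-+ (g x) _ ys))

sum-map-concatMap : ∀ (g : B → ℕ) (h : A → List B) xs →
  sum (map g (concatMap h xs)) ≡ sum (map (λ x → sum (map g (h x))) xs)
sum-map-concatMap g h []       = refl
sum-map-concatMap g h (x ∷ xs) =
  trans (sum-map-++ g (h x) (concatMap h xs)) (cong (sum (map g (h x)) +_) (sum-map-concatMap g h xs))

sum-map-upTo-suc : ∀ (g : ℕ → ℕ) n → sum (map g (upTo (suc n))) ≡ g 0 + sum (map (g ∘ suc) (upTo n))
sum-map-upTo-suc g n =
  cong (λ ys → g 0 + sum ys) (trans (map-applyUpTo suc g n) (sym (map-upTo (g ∘ suc) n)))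

count≡sum-toℕ : ∀ (p : A → Bool) xs → count p xs ≡ sum (map (toℕ ∘ p) xs)
count≡sum-toℕ p []       = refl
count≡sum-toℕ p (x ∷ xs) with p x
... | true  = cong suc (count≡sum-toℕ p xs)
... | false = count≡sum-toℕ p xs

length-filter≡count : ∀ {P : A → Set} (P? : ∀ x → Dec (P x)) xs →
  length (filter P? xs) ≡ count (λ x → does (P? x)) xs
length-filter≡count P? []       = refl
length-filter≡count P? (x ∷ xs) with does (P? x)
... | true  = cong suc (length-filter≡count P? xs)
... | false = length-filter≡count P? xs

count-false : ∀ (xs : List A) → count (λ _ → false) xs ≡ 0
count-false []       = refl
count-false (x ∷ xs) = count-false xs

count-not : ∀ (p : A → Bool) xs → count (not ∘ p) xs + count p xs ≡ length xs
count-not p []       = refl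
count-not p (x ∷ xs) with p x
... | true  = trans (+-suc _ _) (cong suc (count-not p xs))
... | false = cong suc (count-not p xs)

count-map-++-map : ∀ (p : B → Bool) (g h : A → B) xs →
  count p (map g xs ++ map h xs) ≡ count (p ∘ g) xs + count (p ∘ h) xs
count-map-++-map p g h xs = begin
  count p (map g xs ++ map h xs)
    ≡⟨ count≡sum-toℕ p (map g xs ++ map h xs) ⟩
  sum (map (toℕ ∘ p) (map g xs ++ map h xs))
    ≡⟨ sum-map-++ (toℕ ∘ p) (map g xs) (map h xs) ⟩
  sum (map (toℕ ∘ p) (map g xs)) + sum (map (toℕ ∘ p) (map h xs))
    ≡⟨ sym (cong₂ _+_ (cong sum (map-∘ xs)) (cong sum (map-∘ xs))) ⟩
  sum (map (toℕ ∘ p ∘ g) xs) + sum (map (toℕ ∘ p ∘ h) xs)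
    ≡⟨ sym (cong₂ _+_ (count≡sum-toℕ (p ∘ g) xs) (count≡sum-toℕ (p ∘ h) xs)) ⟩
  count (p ∘ g) xs + count (p ∘ h) xs ∎

length-map-++-map : ∀ (g h : A → B) xs → length (map g xs ++ map h xs) ≡ 2 * length xs
length-map-++-map g h xs = begin
  length (map g xs ++ map h xs)           ≡⟨ length-++ (map g xs) ⟩
  length (map g xs) + length (map h xs)   ≡⟨ cong₂ _+_ (length-map g xs) (length-map h xs) ⟩
  length xs + length xs                   ≡⟨ cong (length xs +_) (sym (+-identityʳ (length xs))) ⟩
  2 * length xs                           ∎

sum-count-swap : ∀ (r : A → B → Bool) xs ys →
  sum (map (λ y → count (λ x → r x y) xs) ys) ≡ sum (map (λ x → count (r x) ys) xs)
sum-count-swap r xs ys = begin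
  sum (map (λ y → count (λ x → r x y) xs) ys)
    ≡⟨ cong sum (map-cong (λ y → count≡sum-toℕ (λ x → r x y) xs) ys) ⟩
  sum (map (λ y → sum (map (λ x → toℕ (r x y)) xs)) ys)
    ≡⟨ sum-map-swap (λ y x → toℕ (r x y)) ys xs ⟩
  sum (map (λ x → sum (map (toℕ ∘ r x) ys)) xs)
    ≡⟨ sym (cong sum (map-cong (λ x → count≡sum-toℕ (r x) ys) xs)) ⟩
  sum (map (λ x → count (r x) ys) xs) ∎

size≤ : ∀ (P : Vec Bool m) → size P ≤ m
size≤ []          = z≤n
size≤ (true ∷ P)  = s≤s (size≤ P)
size≤ (false ∷ P) = m≤n⇒m≤1+n (size≤ P)

length-allVecs : ∀ m → length (allVecs m) ≡ 2 ^ m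
length-allVecs zero    = refl
length-allVecs (suc m) =
  trans (length-map-++-map (false ∷_) (true ∷_) (allVecs m)) (cong (2 *_) (length-allVecs m))

length-allInst : ∀ (P : Vec Bool m) → length (allInst P) ≡ 2 ^ size P
length-allInst []          = refl
length-allInst (true ∷ P)  =
  trans (length-map-++-map {B = Bool × Inst P} (false ,_) (true ,_) (allInst P)) (cong (2 *_) (length-allInst P))
length-allInst (false ∷ P) = length-allInst P

count-allVecs-suc : ∀ (p : Vec Bool (suc m) → Bool) →
  count p (allVecs (suc m)) ≡ count (p ∘ (false ∷_)) (allVecs m) + count (p ∘ (true ∷_)) (allVecs m)
count-allVecs-suc {m} p = count-map-++-map p (false ∷_) (true ∷_) (allVecs m)

count-allInst-true : ∀ (P : Vec Bool m) (p : Bool × Inst P → Bool) →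
  count p (allInst (true ∷ P)) ≡ count (p ∘ (false ,_)) (allInst P) + count (p ∘ (true ,_)) (allInst P)
count-allInst-true P p = count-map-++-map p (false ,_) (true ,_) (allInst P)

count-instEq : ∀ (P : Vec Bool m) δ → count (instEq P δ) (allInst P) ≡ 1
count-instEq []          _           = refl
count-instEq (false ∷ P) δ           = count-instEq P δ
count-instEq (true ∷ P)  (false , δ) =
  trans (count-allInst-true P _) (cong₂ _+_ (count-instEq P δ) (count-false (allInst P)))
count-instEq (true ∷ P)  (true , δ)  =
  trans (count-allInst-true P _) (cong₂ _+_ (count-false (allInst P)) (count-instEq P δ))

count-restrict : ∀ (P : Vec Bool m) γ →
  count (λ x → instEq P (restrict P x) γ) (allVecs m) ≡ 2 ^ (m ∸ size P)
count-restrict []                   _           = refl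
count-restrict {suc m} (true ∷ P)  (false , γ) = trans (count-allVecs-suc {m = m} _)
  (trans (cong₂ _+_ (count-restrict P γ) (count-false (allVecs m))) (+-identityʳ _))
count-restrict {suc m} (true ∷ P)  (true , γ)  = trans (count-allVecs-suc {m = m} _)
  (cong₂ _+_ (count-false (allVecs m)) (count-restrict P γ))
count-restrict {suc m} (false ∷ P) γ           = begin
  count (λ x → instEq (false ∷ P) (restrict (false ∷ P) x) γ) (allVecs (suc m))
    ≡⟨ count-allVecs-suc {m = m} _ ⟩
  count (λ x → instEq P (restrict P x) γ) (allVecs m) + count (λ x → instEq P (restrict P x) γ) (allVecs m)
    ≡⟨ cong₂ _+_ (count-restrict P γ) (trans (count-restrict P γ) (sym (+-identityʳ _))) ⟩
  2 ^ suc (m ∸ size P) ≡⟨ cong (2 ^_) (sym (+-∸-assoc 1 (size≤ P))) ⟩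
  2 ^ (suc m ∸ size P) ∎

count-size : ∀ m k → count (λ P → size P ≡ᵇ k) (allVecs m) ≡ m C k
count-size zero    zero    = refl
count-size zero    (suc k) = refl
count-size (suc m) zero    =
  trans (count-allVecs-suc {m = m} _) (cong₂ _+_ (count-size m zero) (count-false (allVecs m)))
count-size (suc m) (suc k) = begin
  count (λ P → size P ≡ᵇ suc k) (allVecs (suc m))
    ≡⟨ count-allVecs-suc {m = m} _ ⟩
  count (λ P → size P ≡ᵇ suc k) (allVecs m) + count (λ P → size P ≡ᵇ k) (allVecs m)
    ≡⟨ cong₂ _+_ (count-size m (suc k)) (count-size m k) ⟩
  m C suc k + m C k ≡⟨ +-comm (m C suc k) (m C k) ⟩
  m C k + m C suc k ≡⟨ nCk+nC[k+1]≡[n+1]C[k+1] m k ⟩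
  suc m C suc k     ∎

vandermonde : ∀ a b k → sum (map (λ j → (a C j) * (b C (k ∸ j))) (upTo (suc k))) ≡ (a + b) C k
vandermonde zero    b k       = begin
  sum (map (λ j → (0 C j) * (b C (k ∸ j))) (upTo (suc k)))
    ≡⟨ sum-map-upTo-suc (λ j → (0 C j) * (b C (k ∸ j))) k ⟩
  b C k + 0 + sum (map (λ _ → 0) (upTo k))
    ≡⟨ cong₂ _+_ (+-identityʳ (b C k)) (sum-map-const 0 (upTo k)) ⟩
  b C k + length (upTo k) * 0
    ≡⟨ cong (b C k +_) (*-zeroʳ (length (upTo k))) ⟩
  b C k + 0
    ≡⟨ +-identityʳ (b C k) ⟩
  b C k ∎
vandermonde (suc a) b zero    = refl
vandermonde (suc a) b (suc k) = begin
  sum (map (term (suc a) (suc k)) (upTo (suc (suc k))))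
    ≡⟨ sum-map-upTo-suc (term (suc a) (suc k)) (suc k) ⟩
  b C suc k + 0 + sum (map (λ j → (suc a C suc j) * (b C (k ∸ j))) (upTo (suc k)))
    ≡⟨ cong (b C suc k + 0 +_) pascal ⟩
  b C suc k + 0 + (sum (map (term a k) (upTo (suc k))) + shifted)
    ≡⟨ cong (b C suc k + 0 +_) (+-comm (sum (map (term a k) (upTo (suc k)))) shifted) ⟩
  b C suc k + 0 + (shifted + sum (map (term a k) (upTo (suc k))))
    ≡⟨ sym (+-assoc (b C suc k + 0) shifted _) ⟩
  b C suc k + 0 + shifted + sum (map (term a k) (upTo (suc k)))
    ≡⟨ cong (_+ sum (map (term a k) (upTo (suc k)))) (sym (sum-map-upTo-suc (term a (suc k)) (suc k))) ⟩
  sum (map (term a (suc k)) (upTo (suc (suc k)))) + sum (map (term a k) (upTo (suc k)))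
    ≡⟨ cong₂ _+_ (vandermonde a b (suc k)) (vandermonde a b k) ⟩
  (a + b) C suc k + (a + b) C k      ≡⟨ +-comm ((a + b) C suc k) ((a + b) C k) ⟩
  (a + b) C k + (a + b) C suc k      ≡⟨ nCk+nC[k+1]≡[n+1]C[k+1] (a + b) k ⟩
  suc (a + b) C suc k                ∎
  where
  term : ℕ → ℕ → ℕ → ℕ
  term x y j = (x C j) * (b C (y ∸ j))
  shifted : ℕ
  shifted = sum (map (λ j → (a C suc j) * (b C (k ∸ j))) (upTo (suc k)))
  pascal : sum (map (λ j → (suc a C suc j) * (b C (k ∸ j))) (upTo (suc k)))
         ≡ sum (map (term a k) (upTo (suc k))) + shifted
  pascal = trans (cong sum (map-cong (λ j → trans (cong (_* (b C (k ∸ j))) (sym (nCk+nC[k+1]≡[n+1]C[k+1] a j)))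
                                                   (*-distribʳ-+ (b C (k ∸ j)) (a C j) (a C suc j))) (upTo (suc k))))
                 (sum-map-+ (term a k) _ (upTo (suc k)))

-- The left summand is 1 if a = false and 2^|P| - 1 if a = true; the statement avoids truncated
-- subtraction so that it can be summed over swaps.
count-xor-instEq : ∀ (P : Vec Bool m) δ a →
  count (λ γ → a xor instEq P δ γ) (allInst P) + 2 * toℕ a ≡ 1 + 2 ^ size P * toℕ a
count-xor-instEq P δ false =
  trans (+-identityʳ _) (trans (count-instEq P δ) (cong suc (sym (*-zeroʳ (2 ^ size P)))))
count-xor-instEq P δ true  = begin
  c + 2                                  ≡⟨ +-suc c 1 ⟩
  suc (c + 1)                            ≡⟨ cong (λ n → suc (c + n)) (sym (count-instEq P δ)) ⟩
  suc (c + count (instEq P δ) (allInst P)) ≡⟨ cong suc (count-not (instEq P δ) (allInst P)) ⟩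
  suc (length (allInst P))               ≡⟨ cong suc (trans (length-allInst P) (sym (*-identityʳ _))) ⟩
  1 + 2 ^ size P * 1                     ∎
  where
  c = count (not ∘ instEq P δ) (allInst P)

sum-Δ-Nγ : ∀ (P : Vec Bool m) γ (P' : Vec Bool m) → size P' ≡ size P →
  sum (map (Δ (Nγ P γ)) (map (Nγ P') (allInst P'))) + 2 ^ suc (m ∸ size P) ≡ 2 ^ suc m
sum-Δ-Nγ {m} P γ P' |P'|≡|P| = begin
  sum (map (Δ (Nγ P γ)) (map (Nγ P') (allInst P'))) + 2 * 2 ^ (m ∸ size P)
    ≡⟨ cong₂ (λ V c → V + 2 * c) double-count (sym matches) ⟩
  sum (map d X) + 2 * sum (map (toℕ ∘ v) X)
    ≡⟨ cong (sum (map d X) +_) (sym (sum-map-*ˡ 2 (toℕ ∘ v) X)) ⟩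
  sum (map d X) + sum (map (λ x → 2 * toℕ (v x)) X)
    ≡⟨ sym (sum-map-+ d (λ x → 2 * toℕ (v x)) X) ⟩
  sum (map (λ x → d x + 2 * toℕ (v x)) X)
    ≡⟨ cong sum (map-cong (λ x → count-xor-instEq P' (restrict P' x) (v x)) X) ⟩
  sum (map (λ x → 1 + 2 ^ size P' * toℕ (v x)) X)
    ≡⟨ sum-map-+ (λ _ → 1) (λ x → 2 ^ size P' * toℕ (v x)) X ⟩
  sum (map (λ _ → 1) X) + sum (map (λ x → 2 ^ size P' * toℕ (v x)) X)
    ≡⟨ cong₂ _+_ (sum-map-const 1 X) (sum-map-*ˡ (2 ^ size P') (toℕ ∘ v) X) ⟩
  length X * 1 + 2 ^ size P' * sum (map (toℕ ∘ v) X)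
    ≡⟨ cong₂ _+_ (trans (*-identityʳ (length X)) (length-allVecs m)) (cong₂ _*_ (cong (2 ^_) |P'|≡|P|) matches) ⟩
  2 ^ m + 2 ^ size P * 2 ^ (m ∸ size P)
    ≡⟨ cong (2 ^ m +_) (sym (^-distribˡ-+-* 2 (size P) (m ∸ size P))) ⟩
  2 ^ m + 2 ^ (size P + (m ∸ size P))
    ≡⟨ cong (λ e → 2 ^ m + 2 ^ e) (m+[n∸m]≡n (size≤ P)) ⟩
  2 ^ m + 2 ^ m
    ≡⟨ cong (2 ^ m +_) (sym (+-identityʳ (2 ^ m))) ⟩
  2 ^ suc m ∎
  where
  X = allVecs m
  v : Vec Bool m → Bool
  v = vote (Nγ P γ)
  d : Vec Bool m → ℕ
  d x = count (λ γ' → v x xor instEq P' (restrict P' x) γ') (allInst P')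
  matches : sum (map (toℕ ∘ v) X) ≡ 2 ^ (m ∸ size P)
  matches = trans (sym (count≡sum-toℕ v X)) (count-restrict P γ)
  double-count : sum (map (Δ (Nγ P γ)) (map (Nγ P') (allInst P'))) ≡ sum (map d X)
  double-count = trans (sym (cong sum (map-∘ (allInst P'))))
                       (sum-count-swap (λ x γ' → v x xor vote (Nγ P' γ') x) X (allInst P'))

f-Tkn-Nγ : ∀ {k} (P : Vec Bool m) γ → size P ≡ k →
  f (Tkn k m) (Nγ P γ) ≡ (2 ^ suc m ∸ 2 ^ suc (m ∸ k)) * (m C k)
f-Tkn-Nγ {m} {k} P γ refl = begin
  f (Tkn k m) (Nγ P γ)
    ≡⟨ sum-map-concatMap (Δ (Nγ P γ)) block F ⟩
  sum (map (λ P' → sum (map (Δ (Nγ P γ)) (block P'))) F)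
    ≡⟨ sum-map-≡const (All.map (λ {P'} → block-value P') (all-filter (λ P' → size P' ≟ k) (allVecs m))) ⟩
  length F * W
    ≡⟨ cong (_* W) (trans (length-filter≡count (λ P' → size P' ≟ k) (allVecs m)) (count-size m k)) ⟩
  (m C k) * W
    ≡⟨ *-comm (m C k) W ⟩
  W * (m C k) ∎
  where
  block : Vec Bool m → List (CPT m)
  block P' = map (Nγ P') (allInst P')
  F = filter (λ P' → size P' ≟ k) (allVecs m)
  W = 2 ^ suc m ∸ 2 ^ suc (m ∸ k)
  block-value : ∀ P' → size P' ≡ k → sum (map (Δ (Nγ P γ)) (block P')) ≡ W
  block-value P' |P'|≡k = trans (sym (m+n∸n≡m _ (2 ^ suc (m ∸ k))))
                                (cong (_∸ 2 ^ suc (m ∸ k)) (sum-Δ-Nγ P γ P' |P'|≡k))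

rhs-suc : ∀ {k} → k ≤ m → rhs k (suc m) ≡ (2 ^ suc m ∸ 2 ^ suc (m ∸ k)) * (m C k)
rhs-suc {m} {k} k≤m = cong₂ _*_ (cong (λ e → 2 ^ suc m ∸ 2 ^ e) (+-∸-assoc 1 k≤m)) (begin
  sum (map (λ j → (k C j) * ((suc m ∸ k ∸ 1) C (k ∸ j))) (upTo (suc k)))
    ≡⟨ vandermonde k (suc m ∸ k ∸ 1) k ⟩
  (k + (suc m ∸ k ∸ 1)) C k
    ≡⟨ cong (λ b → (k + b) C k) (trans (∸-+-assoc (suc m) k 1) (cong (suc m ∸_) (+-comm k 1))) ⟩
  (k + (m ∸ k)) C k
    ≡⟨ cong (_C k) (m+[n∸m]≡n k≤m) ⟩
  m C k ∎)

∈-Tkn : ∀ {k} {N : CPT m} → N ∈ Tkn k m → ∃[ P ] ∃[ γ ] size P ≡ k × N ≡ Nγ P γ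
∈-Tkn {m} {k} N∈
  with find (∈-concatMap⁻ (λ P → map (Nγ P) (allInst P)) {xs = filter (λ P → size P ≟ k) (allVecs m)} N∈)
... | P , P∈F , N∈block with ∈-map⁻ (Nγ P) N∈block
... | γ , _ , N≡ = P , γ , proj₂ (∈-filter⁻ (λ P → size P ≟ k) {xs = allVecs m} P∈F) , N≡

lemma20 : (n k : ℕ) → 3 ≤ n → 2 ≤ k → k ≤ n ∸ 1 →
    (s : Fin (length (Tkn k (n ∸ 1)))) →
    f (Tkn k (n ∸ 1)) (lookup (Tkn k (n ∸ 1)) s) ≡ rhs k n
lemma20 (suc m) k _ _ k≤m s with ∈-Tkn (∈-lookup s)
... | P , γ , |P|≡k , N≡ = begin
  f (Tkn k m) (lookup (Tkn k m) s) ≡⟨ cong (f (Tkn k m)) N≡ ⟩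
  f (Tkn k m) (Nγ P γ)             ≡⟨ f-Tkn-Nγ P γ |P|≡k ⟩
  (2 ^ suc m ∸ 2 ^ suc (m ∸ k)) * (m C k) ≡⟨ sym (rhs-suc k≤m) ⟩
  rhs k (suc m)                    ∎
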